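{- Let $T$ be a digraph with $m\ge 2$ vertices $u_1,\dots,u_m$ which has a good quasi-kernel, and let $H_1,\dots,H_m$ be arbitrary digraphs. Then the composition $D=T[H_1,\dots,H_m]$ has a good quasi-kernel. Consequently, $D$ has a quasi-kernel of size at most $|V(D)|/2$.
   Context: A quasi-kernel of a digraph $D$ is an independent set $Q\subseteq V(D)$ such that for every vertex $v\in V(D)\setminus Q$ there is a directed path with one or two arcs from $v$ to some vertex of $Q$. A quasi-kernel $Q$ is good if for each $u\in Q$ there is an arc from $u$ to a vertex which is an in-neighbour of some vertex of $Q$. The composition $T[H_1,\dots,H_m]$ is the digraph with vertex set $\bigcup_i\{u_{i,j}: j\in V(H_i)\}$ (a disjoint copy of each $H_i$ replacing $u_i$) and arc set consisting of all arcs of each copy of $H_i$ together with all arcs $u_{i,j}u_{p,q}$ for every arc $u_iu_p\in A(T)$ and all $j\in V(H_i)$, $q\in V(H_p)$. -}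

module Defs where

open import Data.Nat using (ℕ; zero; suc; _+_)
open import Data.Fin using (Fin; zero; suc; splitAt; _≟_)
open import Data.Fin.Subset using (Subset; _∈_; _∉_)
open import Data.Bool using (Bool; true; false; T)
open import Data.Product using (Σ; _×_; _,_; ∃; ∃-syntax)
open import Data.Sum using (_⊎_; inj₁; inj₂)
open import Relation.Nullary using (¬_; yes; no)
open import Relation.Binary.PropositionalEquality using (_≡_; refl)

-- A (finite) digraph on the vertex set Fin n, given by its (decidable)
-- adjacency relation: arc u v = true iff there is an arc u → v.
-- (Parallel arcs are impossible by construction.)
Digraph : ℕ → Set
Digraph n = Fin n → Fin n → Bool

Arc : ∀ {n} → Digraph n → Fin n → Fin n → Set
Arc D u v = T (D u v)

Loopless : ∀ {n} → Digraph n → Set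
Loopless D = ∀ v → D v v ≡ false

Independent : ∀ {n} → Digraph n → Subset n → Set
Independent D Q = ∀ u v → u ∈ Q → v ∈ Q → ¬ Arc D u v

Reach≤2 : ∀ {n} → Digraph n → Fin n → Fin n → Set
Reach≤2 D v w = Arc D v w ⊎ (∃[ x ] (Arc D v x × Arc D x w))

QuasiKernel : ∀ {n} → Digraph n → Subset n → Set
QuasiKernel D Q =
  Independent D Q × (∀ v → v ∉ Q → ∃[ w ] (w ∈ Q × Reach≤2 D v w))

IsGood : ∀ {n} → Digraph n → Subset n → Set
IsGood D Q = ∀ u → u ∈ Q → ∃[ x ] (Arc D u x × ∃[ w ] (w ∈ Q × Arc D x w))

GoodQuasiKernel : ∀ {n} → Digraph n → Subset n → Set
GoodQuasiKernel D Q = QuasiKernel D Q × IsGood D Q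

∑ : (m : ℕ) → (Fin m → ℕ) → ℕ
∑ zero    n = 0
∑ (suc m) n = n zero + ∑ m (λ i → n (suc i))

-- The vertex set of the composition is Fin (∑ m n), identified with
-- pairs (i , j) (vertex u_{i,j}, j ∈ V(H_i)) block by block.
unflatten : (m : ℕ) (n : Fin m → ℕ) → Fin (∑ m n) → Σ (Fin m) (λ i → Fin (n i))
unflatten zero    n ()
unflatten (suc m) n x with splitAt (n zero) x
... | inj₁ j = zero , j
... | inj₂ y with unflatten m (λ i → n (suc i)) y
...   | i , k = suc i , k

compArc : {m : ℕ} {n : Fin m → ℕ} → Digraph m → ((i : Fin m) → Digraph (n i)) →
          Σ (Fin m) (λ i → Fin (n i)) → Σ (Fin m) (λ i → Fin (n i)) → Bool
compArc Tg H (i , j) (p , q) with i ≟ p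
... | yes refl = H i j q
... | no _     = Tg i p

composition : {m : ℕ} {n : Fin m → ℕ} → Digraph m → ((i : Fin m) → Digraph (n i)) →
              Digraph (∑ m n)
composition {m} {n} Tg H x y = compArc Tg H (unflatten m n x) (unflatten m n y)

-- Fix a vertex rep i in every block H_i. As T is loopless, an arc i → p of T yields arcs from
-- every vertex of block i to rep p, while distinct reps are adjacent exactly as in T; hence the
-- reps of a good quasi-kernel of T form a good quasi-kernel of D.
-- For the size bound, let Q be a good quasi-kernel of any digraph and let every vertex with an
-- out-neighbour in Q choose one. Every vertex reaches Q in at most two steps, and the last step
-- can be redirected to a chosen vertex, so the chosen vertices form a good quasi-kernel again.
-- Each chosen q was chosen by some in-neighbour, which lies outside Q by independence; distinct
-- chosen vertices have distinct choosers, so at most half of the vertices are chosen.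
module Submission where

open import Defs
open import Level using (0ℓ)
open import Function using (_∘′_)
open import Data.Bool using (T; false)
open import Data.Nat using (ℕ; suc; _≤_; _*_; _+_; z≤n; s≤s)
open import Data.Nat.Properties using (m≤o∸n⇒m+n≤o; +-identityʳ; module ≤-Reasoning)
open import Data.Fin using (Fin; zero; suc; _≟_; _↑ˡ_; _↑ʳ_; fromℕ<)
open import Data.Fin.Properties using (any?; splitAt-↑ˡ; splitAt-↑ʳ)
open import Data.Fin.Subset using (Subset; ∣_∣; _∈_; _∉_; _⊆_; ∁; _─_; _-_; inside; outside)
open import Data.Fin.Subset.Properties
  using (_∈?_; nonempty?; Empty-unique; ∣⊥∣≡0; ∣p∣≤n; ∣∁p∣≡n∸∣p∣; p─⊥≡p; p─q⊆p;
         x∈p⇒p-x⊂p; x∈p⇒∣p-x∣<∣p∣; x∈p∧x≢y⇒x∈p-y; x∉⁅y⁆⇒x≢y; x∉p⇒x∈∁p)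
open import Data.Fin.Subset.Induction using (⊂-wellFounded; Acc; acc)
open import Data.Vec using (_∷_; tabulate; here; there)
open import Data.Vec.Properties using (lookup∘tabulate; []=⇒lookup; lookup⇒[]=)
open import Data.Product using (Σ; _×_; _,_; ∃-syntax; proj₁; proj₂)
open import Data.Sum using (inj₁; inj₂)
open import Relation.Nullary using (Dec; yes; no; does; contradiction)
open import Relation.Nullary.Decidable using (dec-true; _×-dec_; T?)
open import Relation.Unary using (Pred; Decidable)
open import Relation.Binary.PropositionalEquality

private
  variable
    k n : ℕ

select : {P : Pred (Fin n) 0ℓ} → Decidable P → Subset n
select P? = tabulate λ x → does (P? x)

module _ {P : Pred (Fin n) 0ℓ} (P? : Decidable P) where
  ∈-select⁺ : ∀ {x} → P x → x ∈ select P?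
  ∈-select⁺ {x} px = lookup⇒[]= x _ (trans (lookup∘tabulate _ x) (dec-true (P? x) px))

  ∈-select⁻ : ∀ {x} → x ∈ select P? → P x
  ∈-select⁻ {x} x∈ with P? x | trans (sym (lookup∘tabulate (λ y → does (P? y)) x)) ([]=⇒lookup x∈)
  ... | yes px | _ = px
  ... | no  _  | ()

Image : (Fin k → Fin n) → Subset k → Pred (Fin n) 0ℓ
Image f p y = ∃[ x ] (x ∈ p × f x ≡ y)

image? : (f : Fin k → Fin n) (p : Subset k) → Decidable (Image f p)
image? f p y = any? λ x → x ∈? p ×-dec f x ≟ y

image : (Fin k → Fin n) → Subset k → Subset n
image f p = select (image? f p)

module _ (f : Fin k → Fin n) {p : Subset k} where
  ∈-image⁺ : ∀ {x} → x ∈ p → f x ∈ image f p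
  ∈-image⁺ x∈p = ∈-select⁺ (image? f p) (_ , x∈p , refl)

  ∈-image⁻ : ∀ {y} → y ∈ image f p → ∃[ x ] (x ∈ p × f x ≡ y)
  ∈-image⁻ = ∈-select⁻ (image? f p)

x∈p─q⇒x∉q : ∀ {x} {p q : Subset n} → x ∈ p ─ q → x ∉ q
x∈p─q⇒x∉q {p = _ ∷ p} {outside ∷ q} (there x∈p─q) (there x∈q) = x∈p─q⇒x∉q x∈p─q x∈q
x∈p─q⇒x∉q {p = _ ∷ p} {inside  ∷ q} (there x∈p─q) (there x∈q) = x∈p─q⇒x∉q x∈p─q x∈q

x∈p⇒∣p∣≡suc∣p-x∣ : ∀ {x} {p : Subset n} → x ∈ p → ∣ p ∣ ≡ suc ∣ p - x ∣
x∈p⇒∣p∣≡suc∣p-x∣ {x = zero}  {p = _ ∷ p}       here        = cong (suc ∘′ ∣_∣) (sym (p─⊥≡p p))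
x∈p⇒∣p∣≡suc∣p-x∣ {x = suc x} {p = inside  ∷ p} (there x∈p) = cong suc (x∈p⇒∣p∣≡suc∣p-x∣ x∈p)
x∈p⇒∣p∣≡suc∣p-x∣ {x = suc x} {p = outside ∷ p} (there x∈p) = x∈p⇒∣p∣≡suc∣p-x∣ x∈p

p⊆f[q]⇒∣p∣≤∣q∣ : (f : Fin k → Fin n) {p : Subset n} {q : Subset k} → p ⊆ image f q → ∣ p ∣ ≤ ∣ q ∣
p⊆f[q]⇒∣p∣≤∣q∣ {n = n} f {p} = go p (⊂-wellFounded p)
  where
  go : ∀ p {q} → Acc _ p → p ⊆ image f q → ∣ p ∣ ≤ ∣ q ∣
  go p {q} (acc rec) p⊆f[q] with nonempty? p
  ... | no ∄x rewrite Empty-unique ∄x | ∣⊥∣≡0 n = z≤n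
  ... | yes (x , x∈p) with ∈-image⁻ f (p⊆f[q] x∈p)
  ...   | y , y∈q , refl = begin
    ∣ p ∣             ≡⟨ x∈p⇒∣p∣≡suc∣p-x∣ x∈p ⟩
    suc ∣ p - f y ∣   ≤⟨ s≤s (go (p - f y) (rec (x∈p⇒p-x⊂p x∈p)) p-fy⊆f[q-y]) ⟩
    suc ∣ q - y ∣     ≤⟨ x∈p⇒∣p-x∣<∣p∣ y∈q ⟩
    ∣ q ∣             ∎
    where
    open ≤-Reasoning
    p-fy⊆f[q-y] : p - f y ⊆ image f (q - y)
    p-fy⊆f[q-y] x′∈ with ∈-image⁻ f (p⊆f[q] (p─q⊆p _ _ x′∈))
    ... | y′ , y′∈q , refl = ∈-image⁺ f
      (x∈p∧x≢y⇒x∈p-y y′∈q λ { refl → x∉⁅y⁆⇒x≢y (x∈p─q⇒x∉q x′∈) refl })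

∣p∣≤∣∁p∣⇒2*∣p∣≤n : (p : Subset n) → ∣ p ∣ ≤ ∣ ∁ p ∣ → 2 * ∣ p ∣ ≤ n
∣p∣≤∣∁p∣⇒2*∣p∣≤n {n} p ∣p∣≤∣∁p∣ =
  subst (_≤ n) (cong (∣ p ∣ +_) (sym (+-identityʳ ∣ p ∣)))
    (m≤o∸n⇒m+n≤o ∣ p ∣ (∣p∣≤n p) (subst (∣ p ∣ ≤_) (∣∁p∣≡n∸∣p∣ p) ∣p∣≤∣∁p∣))

Absorbed : Digraph n → Subset n → Fin n → Set
Absorbed D Q v = ∃[ w ] (w ∈ Q × Reach≤2 D v w)

absorbed-by-good : {D : Digraph n} {Q : Subset n} → GoodQuasiKernel D Q → ∀ v → Absorbed D Q v
absorbed-by-good {Q = Q} ((_ , absorbing) , good) v with v ∈? Q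
... | no  v∉Q = absorbing v v∉Q
... | yes v∈Q with good v v∈Q
...   | x , v→x , w , w∈Q , x→w = w , w∈Q , inj₂ (x , v→x , x→w)

module _ (D : Digraph n) (Q : Subset n) where
  arcInto? : ∀ r → Dec (∃[ q ] (q ∈ Q × Arc D r q))
  arcInto? r = any? λ q → q ∈? Q ×-dec T? (D r q)

  -- The default r is never used: choice is only consulted at vertices with an arc into Q.
  choice : Fin n → Fin n
  choice r with arcInto? r
  ... | yes (q , _) = q
  ... | no  _       = r

  choice-spec : ∀ {r q} → q ∈ Q → Arc D r q → choice r ∈ Q × Arc D r (choice r)
  choice-spec {r} q∈Q r→q with arcInto? r
  ... | yes (_ , spec) = spec
  ... | no  ∄q         = contradiction (_ , q∈Q , r→q) ∄q

  chosen : Subset n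
  chosen = image choice (select arcInto?)

  ∈-chosen⁻ : ∀ {q} → q ∈ chosen → ∃[ r ] (q ∈ Q × Arc D r q × choice r ≡ q)
  ∈-chosen⁻ q∈ with ∈-image⁻ choice q∈
  ... | r , r∈ , refl =
    let _ , q∈Q , r→q = ∈-select⁻ arcInto? r∈
        c∈Q , r→c     = choice-spec q∈Q r→q
    in r , c∈Q , r→c , refl

  arc-to-chosen : ∀ {r q} → q ∈ Q → Arc D r q → ∃[ w ] (w ∈ chosen × Arc D r w)
  arc-to-chosen q∈Q r→q =
    choice _ , ∈-image⁺ choice (∈-select⁺ arcInto? (_ , q∈Q , r→q)) , proj₂ (choice-spec q∈Q r→q)

  chosen-absorbs : ∀ {v w} → w ∈ Q → Reach≤2 D v w → Absorbed D chosen v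
  chosen-absorbs w∈Q (inj₁ v→w) with arc-to-chosen w∈Q v→w
  ... | w′ , w′∈ , v→w′ = w′ , w′∈ , inj₁ v→w′
  chosen-absorbs w∈Q (inj₂ (x , v→x , x→w)) with arc-to-chosen w∈Q x→w
  ... | w′ , w′∈ , x→w′ = w′ , w′∈ , inj₂ (x , v→x , x→w′)

  chosen-goodQuasiKernel : GoodQuasiKernel D Q → GoodQuasiKernel D chosen
  chosen-goodQuasiKernel gqk@((independent , _) , good) = (independent′ , absorbing′) , good′
    where
    chosen⊆Q : chosen ⊆ Q
    chosen⊆Q q∈ = proj₁ (proj₂ (∈-chosen⁻ q∈))

    independent′ : Independent D chosen
    independent′ u v u∈ v∈ = independent u v (chosen⊆Q u∈) (chosen⊆Q v∈)

    absorbing′ : ∀ v → v ∉ chosen → Absorbed D chosen v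
    absorbing′ v _ with absorbed-by-good gqk v
    ... | w , w∈Q , v⇝w = chosen-absorbs w∈Q v⇝w

    good′ : IsGood D chosen
    good′ u u∈ with good u (chosen⊆Q u∈)
    ... | x , u→x , w , w∈Q , x→w = x , u→x , arc-to-chosen w∈Q x→w

  chosen-size : Independent D Q → 2 * ∣ chosen ∣ ≤ n
  chosen-size independent = ∣p∣≤∣∁p∣⇒2*∣p∣≤n chosen (p⊆f[q]⇒∣p∣≤∣q∣ choice chosen⊆choice[∁chosen])
    where
    chosen⊆choice[∁chosen] : chosen ⊆ image choice (∁ chosen)
    chosen⊆choice[∁chosen] q∈ with ∈-chosen⁻ q∈
    ... | r , q∈Q , r→q , refl = ∈-image⁺ choice
      (x∉p⇒x∈∁p λ r∈ → independent r _ (proj₁ (proj₂ (∈-chosen⁻ r∈))) q∈Q r→q)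

flatten : (m : ℕ) (n : Fin m → ℕ) → Σ (Fin m) (λ i → Fin (n i)) → Fin (∑ m n)
flatten (suc m) n (zero  , j) = j ↑ˡ ∑ m (λ i → n (suc i))
flatten (suc m) n (suc i , j) = n zero ↑ʳ flatten m (λ i → n (suc i)) (i , j)

unflatten-flatten : (m : ℕ) (n : Fin m → ℕ) → ∀ s → unflatten m n (flatten m n s) ≡ s
unflatten-flatten (suc m) n (zero , j)
  rewrite splitAt-↑ˡ (n zero) j (∑ m (λ i → n (suc i))) = refl
unflatten-flatten (suc m) n (suc i , j)
  rewrite splitAt-↑ʳ (n zero) (∑ m (λ i → n (suc i))) (flatten m (λ i → n (suc i)) (i , j))
        | unflatten-flatten m (λ i → n (suc i)) (i , j) = refl

module _ {m} {n : Fin m → ℕ} (Tg : Digraph m) (H : ∀ i → Digraph (n i)) where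
  private
    D = composition Tg H

  block : Fin (∑ m n) → Fin m
  block x = proj₁ (unflatten m n x)

  composition-across : ∀ {x y} → block x ≢ block y → D x y ≡ Tg (block x) (block y)
  composition-across {x} {y} = across (unflatten m n x) (unflatten m n y)
    where
    across : ∀ s t → proj₁ s ≢ proj₁ t → compArc Tg H s t ≡ Tg (proj₁ s) (proj₁ t)
    across (i , _) (p , _) i≢p with i ≟ p
    ... | yes refl = contradiction refl i≢p
    ... | no  _    = refl

  composition-loopless : (∀ i → Loopless (H i)) → Loopless D
  composition-loopless H-loopless x = diagonal (unflatten m n x)
    where
    diagonal : ∀ s → compArc Tg H s s ≡ false
    diagonal (i , j) with i ≟ i
    ... | yes refl = H-loopless i j
    ... | no  i≢i  = contradiction refl i≢i

  arc-lift : Loopless Tg → ∀ {x y} → Arc Tg (block x) (block y) → Arc D x y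
  arc-lift Tg-loopless {x} {y} a = subst T (sym (composition-across x≢y)) a
    where
    x≢y : block x ≢ block y
    x≢y x≡y = subst T (Tg-loopless (block y)) (subst (λ b → Arc Tg b (block y)) x≡y a)

  module _ (nonempty : ∀ i → 1 ≤ n i) where
    rep : Fin m → Fin (∑ m n)
    rep i = flatten m n (i , fromℕ< (nonempty i))

    block-rep : ∀ i → block (rep i) ≡ i
    block-rep i = cong proj₁ (unflatten-flatten m n _)

    arc-to-rep : Loopless Tg → ∀ {x i} → Arc Tg (block x) i → Arc D x (rep i)
    arc-to-rep Tg-loopless {x} {i} a =
      arc-lift Tg-loopless (subst (Arc Tg (block x)) (sym (block-rep i)) a)

    arc-rep : Loopless Tg → ∀ {i p} → Arc Tg i p → Arc D (rep i) (rep p)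
    arc-rep Tg-loopless {i} a =
      arc-to-rep Tg-loopless (subst (λ b → Arc Tg b _) (sym (block-rep i)) a)

    arc-rep⁻ : (∀ i → Loopless (H i)) → ∀ {i p} → Arc D (rep i) (rep p) → Arc Tg i p
    arc-rep⁻ H-loopless {i} {p} a with i ≟ p
    ... | yes refl = contradiction a (subst T (composition-loopless H-loopless (rep i)))
    ... | no  i≢p  = subst₂ (Arc Tg) (block-rep i) (block-rep p) (subst T (composition-across blocks≢) a)
      where
      blocks≢ : block (rep i) ≢ block (rep p)
      blocks≢ eq = i≢p (trans (sym (block-rep i)) (trans eq (block-rep p)))

    reach-to-rep : Loopless Tg → ∀ {x w} → Reach≤2 Tg (block x) w → Reach≤2 D x (rep w)
    reach-to-rep Tg-loopless (inj₁ x→w)             = inj₁ (arc-to-rep Tg-loopless x→w)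
    reach-to-rep Tg-loopless (inj₂ (y , x→y , y→w)) =
      inj₂ (rep y , arc-to-rep Tg-loopless x→y , arc-rep Tg-loopless y→w)

    rep-goodQuasiKernel : Loopless Tg → (∀ i → Loopless (H i)) → ∀ {Q} →
      GoodQuasiKernel Tg Q → GoodQuasiKernel D (image rep Q)
    rep-goodQuasiKernel Tg-loopless H-loopless {Q} gqk@((independent , _) , good) =
      (independent′ , absorbing′) , good′
      where
      independent′ : Independent D (image rep Q)
      independent′ _ _ x∈ y∈ x→y with ∈-image⁻ rep x∈ | ∈-image⁻ rep y∈
      ... | i , i∈Q , refl | p , p∈Q , refl = independent i p i∈Q p∈Q (arc-rep⁻ H-loopless x→y)

      absorbing′ : ∀ v → v ∉ image rep Q → Absorbed D (image rep Q) v
      absorbing′ v _ with absorbed-by-good gqk (block v)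
      ... | w , w∈Q , v⇝w = rep w , ∈-image⁺ rep w∈Q , reach-to-rep Tg-loopless v⇝w

      good′ : IsGood D (image rep Q)
      good′ _ x∈ with ∈-image⁻ rep x∈
      ... | i , i∈Q , refl with good i i∈Q
      ...   | y , i→y , w , w∈Q , y→w =
        rep y , arc-rep Tg-loopless i→y , rep w , ∈-image⁺ rep w∈Q , arc-rep Tg-loopless y→w

proposition2 : (m : ℕ) → 2 ≤ m → (Tg : Digraph m) → Loopless Tg →
    (n : Fin m → ℕ) → (∀ i → 1 ≤ n i) →
    (H : (i : Fin m) → Digraph (n i)) → (∀ i → Loopless (H i)) →
    (∃[ Q ] GoodQuasiKernel Tg Q) →
    (∃[ Q ] GoodQuasiKernel (composition Tg H) Q)
    × (∃[ Q ] (QuasiKernel (composition Tg H) Q × 2 * ∣ Q ∣ ≤ ∑ m n))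
proposition2 m _ Tg Tg-loopless n nonempty H H-loopless (Q , gqk) =
  (Q′ , gqk′) , (chosen D Q′ , proj₁ (chosen-goodQuasiKernel D Q′ gqk′) , chosen-size D Q′ independent′)
  where
  D  = composition Tg H
  Q′ = image (rep Tg H nonempty) Q

  gqk′ : GoodQuasiKernel D Q′
  gqk′ = rep-goodQuasiKernel Tg H nonempty Tg-loopless H-loopless gqk

  independent′ : Independent D Q′
  independent′ = proj₁ (proj₁ gqk′)
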